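{- Let $\mathcal{M}$ denote the possible-world model over the frame given by the relations $\Gamma \le \Gamma'$ (order-preserving embeddings) and $\Delta \lhd \Gamma$ (IKC modal accessibility) and the valuation $V_{\iota,\Gamma} = (\Gamma \vdash_{\mathrm{ne}} \iota)$. There is a function $\mathrm{quote} : \mathcal{M}([\![\Gamma]\!],[\![A]\!]) \to (\Gamma \vdash_{\mathrm{nf}} A)$ such that the composite $\mathrm{norm} = \mathrm{quote} \circ [\![-]\!] : (\Gamma \vdash A) \to (\Gamma \vdash_{\mathrm{nf}} A)$ from terms to normal forms of IKC is complete and adequate.
   Context: Setting: the Fitch-style modal lambda calculus IKC. Types $A ::= \iota \mid A \to B \mid \Box A$; contexts $\Gamma ::= \cdot \mid \Gamma, A \mid \Gamma,\text{🔒}$ (🔒 a lock). Order-preserving embeddings (OPEs) $\Gamma\le\Gamma'$ embed $\Gamma$ into $\Gamma'$ preserving the order of types and the order and number of locks. The IKC modal accessibility relation $\Delta\lhd\Gamma$ holds exactly when $\Gamma = \Delta,\text{🔒},\Delta'$ with $\Delta'$ lock-free. Terms: variables, $\lambda$, application, $\mathrm{box}$ (from $\Gamma,\text{🔒}\vdash t:A$ get $\Gamma\vdash\mathrm{box}\,t:\Box A$), and $\mathrm{unbox}(t,e)$ (from $\Delta\vdash t:\Box A$ and $e:\Delta\lhd\Gamma$ get $\Gamma\vdash\mathrm{unbox}(t,e):A$). The equational theory $\approx$ comprises $\to$-$\beta$, $\to$-$\eta$, $\Box$-$\beta$: $\mathrm{unbox}(\mathrm{box}\,t,e)\approx$ the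 weakening of $t$ along the OPE $\Delta,\text{🔒}\le\Gamma$ induced by $e$, and $\Box$-$\eta$: $t\approx\mathrm{box}(\mathrm{unbox}(t,\mathrm{nil}))$ with $\mathrm{nil}:\Gamma\lhd\Gamma,\text{🔒}$. Normal forms $\Gamma\vdash_{\mathrm{nf}}A$ and neutrals $\Gamma\vdash_{\mathrm{ne}}A$: neutrals are variables, applications of a neutral to a normal form, and $\mathrm{unbox}(n,e)$ with $n$ neutral and $e:\Delta\lhd\Gamma$; normal forms are neutrals of base type $\iota$, $\lambda$ of a normal form, and $\mathrm{box}$ of a normal form. A possible-world model interprets $[\![\iota]\!]_w = V_{\iota,w}$, $[\![A\to B]\!]_w = \forall w'.\,w R_i w'\to[\![A]\!]_{w'}\to[\![B]\!]_{w'}$, $[\![\Box A]\!]_w = \forall w'.\,wR_iw'\to\forall v.\,w'R_mv\to[\![A]\!]_v$, $[\![\Gamma,\text{🔒}]\!]_w = \sum_u[\![\Gamma]\!]_u\times uR_mw$; $\mathcal{M}([\![\Gamma]\!],[\![A]\!])$ denotes $\forall w.\,[\![\Gamma]\!]_w\to[\![A]\!]_w$, and $[\![t]\!]$ is evaluation of a term. "Complete" means $t\approx u$ implies $\mathrm{norm}\,t = \mathrm{norm}\,u$; "adequate" means $t\approx\mathrm{quote}([\![t]\!])$ for all $t$, so $\mathrm{norm}\,t=\mathrm{norm}\,u$ implies $t\approx u$. -}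

module Defs where

open import Data.Unit using (⊤; tt)
open import Data.Product using (Σ; _×_; _,_; proj₁; proj₂)
open import Relation.Binary.PropositionalEquality using (_≡_)

infixr 7 _⇒_
data Ty : Set where
  ι   : Ty
  _⇒_ : Ty → Ty → Ty
  □   : Ty → Ty

infixl 6 _`,_
data Ctx : Set where
  []   : Ctx
  _`,_ : Ctx → Ty → Ctx
  _,🔒 : Ctx → Ctx

private
  variable
    Γ Γ' Γ'' Δ Δ' : Ctx
    A B : Ty

-- Order-preserving embeddings: Γ ⊆ Γ' embeds Γ into Γ'
-- (this is the paper's Γ ≤ Γ'; locks are preserved in order and number)

data _⊆_ : Ctx → Ctx → Set where
  base  : [] ⊆ []
  drop  : Γ ⊆ Γ' → Γ ⊆ (Γ' `, A)
  keep  : Γ ⊆ Γ' → (Γ `, A) ⊆ (Γ' `, A)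
  keep🔒 : Γ ⊆ Γ' → (Γ ,🔒) ⊆ (Γ' ,🔒)

⊆-refl : Γ ⊆ Γ
⊆-refl {[]}     = base
⊆-refl {Γ `, A} = keep ⊆-refl
⊆-refl {Γ ,🔒}  = keep🔒 ⊆-refl

_∙_ : Γ ⊆ Γ' → Γ' ⊆ Γ'' → Γ ⊆ Γ''
w        ∙ drop w'  = drop (w ∙ w')
base     ∙ base     = base
drop w   ∙ keep w'  = drop (w ∙ w')
keep w   ∙ keep w'  = keep (w ∙ w')
keep🔒 w ∙ keep🔒 w' = keep🔒 (w ∙ w')

-- IKC modal accessibility: Δ ◁ Γ iff Γ = Δ ,🔒 , Δ' with Δ' lock-free

data _◁_ : Ctx → Ctx → Set where
  nil : Δ ◁ (Δ ,🔒)
  ext : Δ ◁ Γ → Δ ◁ (Γ `, A)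

◁⇒⊆ : Δ ◁ Γ → (Δ ,🔒) ⊆ Γ
◁⇒⊆ nil     = ⊆-refl
◁⇒⊆ (ext e) = drop (◁⇒⊆ e)

factor : Δ ◁ Γ → Γ ⊆ Γ' → Σ Ctx (λ Δ' → (Δ ⊆ Δ') × (Δ' ◁ Γ'))
factor nil (drop w) with factor nil w
... | Δ' , w' , e' = Δ' , w' , ext e'
factor nil (keep🔒 w) = _ , w , nil
factor (ext e) (drop w) with factor (ext e) w
... | Δ' , w' , e' = Δ' , w' , ext e'
factor (ext e) (keep w) with factor e w
... | Δ' , w' , e' = Δ' , w' , ext e'

data Var : Ctx → Ty → Set where
  ze : Var (Γ `, A) A
  su : Var Γ A → Var (Γ `, B) A

data Tm : Ctx → Ty → Set where
  var   : Var Γ A → Tm Γ A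
  lam   : Tm (Γ `, A) B → Tm Γ (A ⇒ B)
  app   : Tm Γ (A ⇒ B) → Tm Γ A → Tm Γ B
  box   : Tm (Γ ,🔒) A → Tm Γ (□ A)
  unbox : Tm Δ (□ A) → Δ ◁ Γ → Tm Γ A

wkVar : Γ ⊆ Γ' → Var Γ A → Var Γ' A
wkVar (drop w) x      = su (wkVar w x)
wkVar (keep w) ze     = ze
wkVar (keep w) (su x) = su (wkVar w x)

wkTm : Γ ⊆ Γ' → Tm Γ A → Tm Γ' A
wkTm w (var x)     = var (wkVar w x)
wkTm w (lam t)     = lam (wkTm (keep w) t)
wkTm w (app t u)   = app (wkTm w t) (wkTm w u)
wkTm w (box t)     = box (wkTm (keep🔒 w) t)
wkTm w (unbox t e) with factor e w
... | _ , w' , e' = unbox (wkTm w' t) e'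

-- Substitutions: Sub Γ Δ maps variables of Δ to terms in Γ
data Sub : Ctx → Ctx → Set where
  []   : Sub Γ []
  _`,_ : Sub Γ Δ → Tm Γ A → Sub Γ (Δ `, A)
  lock : Sub Γ' Δ → Γ' ◁ Γ → Sub Γ (Δ ,🔒)

wkSub : Γ ⊆ Γ' → Sub Γ Δ → Sub Γ' Δ
wkSub w []         = []
wkSub w (s `, t)   = wkSub w s `, wkTm w t
wkSub w (lock s e) with factor e w
... | _ , w' , e' = lock (wkSub w' s) e'

idSub : Sub Γ Γ
idSub {[]}     = []
idSub {Γ `, A} = wkSub (drop ⊆-refl) idSub `, var ze
idSub {Γ ,🔒}  = lock idSub nil

factorSub : Δ' ◁ Δ → Sub Γ Δ → Σ Ctx (λ Γ' → Sub Γ' Δ' × (Γ' ◁ Γ))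
factorSub nil     (lock s e) = _ , s , e
factorSub (ext e) (s `, t)   = factorSub e s

substVar : Sub Γ Δ → Var Δ A → Tm Γ A
substVar (s `, t) ze     = t
substVar (s `, t) (su x) = substVar s x

subst : Sub Γ Δ → Tm Δ A → Tm Γ A
subst s (var x)     = substVar s x
subst s (lam t)     = lam (subst (wkSub (drop ⊆-refl) s `, var ze) t)
subst s (app t u)   = app (subst s t) (subst s u)
subst s (box t)     = box (subst (lock s nil) t)
subst s (unbox t e) with factorSub e s
... | _ , s' , e' = unbox (subst s' t) e'

infix 4 _≈_
data _≈_ : Tm Γ A → Tm Γ A → Set where
  ≈-refl  : {t : Tm Γ A} → t ≈ t
  ≈-sym   : {t u : Tm Γ A} → t ≈ u → u ≈ t
  ≈-trans : {t u v : Tm Γ A} → t ≈ u → u ≈ v → t ≈ v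
  cong-lam   : {t t' : Tm (Γ `, A) B} → t ≈ t' → lam t ≈ lam t'
  cong-app   : {t t' : Tm Γ (A ⇒ B)} {u u' : Tm Γ A} →
               t ≈ t' → u ≈ u' → app t u ≈ app t' u'
  cong-box   : {t t' : Tm (Γ ,🔒) A} → t ≈ t' → box t ≈ box t'
  cong-unbox : {t t' : Tm Δ (□ A)} {e : Δ ◁ Γ} → t ≈ t' → unbox t e ≈ unbox t' e
  ⇒-β : (t : Tm (Γ `, A) B) (u : Tm Γ A) → app (lam t) u ≈ subst (idSub `, u) t
  ⇒-η : (t : Tm Γ (A ⇒ B)) → t ≈ lam (app (wkTm (drop ⊆-refl) t) (var ze))
  □-β : (t : Tm (Δ ,🔒) A) (e : Δ ◁ Γ) → unbox (box t) e ≈ wkTm (◁⇒⊆ e) t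
  □-η : (t : Tm Γ (□ A)) → t ≈ box (unbox t nil)

data Ne : Ctx → Ty → Set
data Nf : Ctx → Ty → Set

data Ne where
  var   : Var Γ A → Ne Γ A
  app   : Ne Γ (A ⇒ B) → Nf Γ A → Ne Γ B
  unbox : Ne Δ (□ A) → Δ ◁ Γ → Ne Γ A

data Nf where
  up  : Ne Γ ι → Nf Γ ι
  lam : Nf (Γ `, A) B → Nf Γ (A ⇒ B)
  box : Nf (Γ ,🔒) A → Nf Γ (□ A)

embNe : Ne Γ A → Tm Γ A
embNf : Nf Γ A → Tm Γ A
embNe (var x)     = var x
embNe (app n m)   = app (embNe n) (embNf m)
embNe (unbox n e) = unbox (embNe n) e
embNf (up n)  = embNe n
embNf (lam m) = lam (embNf m)
embNf (box m) = box (embNf m)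

wkNe : Γ ⊆ Γ' → Ne Γ A → Ne Γ' A
wkNf : Γ ⊆ Γ' → Nf Γ A → Nf Γ' A
wkNe w (var x)     = var (wkVar w x)
wkNe w (app n m)   = app (wkNe w n) (wkNf w m)
wkNe w (unbox n e) with factor e w
... | _ , w' , e' = unbox (wkNe w' n) e'
wkNf w (up n)  = up (wkNe w n)
wkNf w (lam m) = lam (wkNf (keep w) m)
wkNf w (box m) = box (wkNf (keep🔒 w) m)

-- The possible-world model M: worlds are contexts, R_i = ⊆ (OPEs),
-- R_m = ◁ (IKC accessibility), V_{ι,Γ} = Ne Γ ι.

⟦_⟧Ty : Ty → Ctx → Set
⟦ ι ⟧Ty     Γ = Ne Γ ι
⟦ A ⇒ B ⟧Ty Γ = ∀ Γ' → Γ ⊆ Γ' → ⟦ A ⟧Ty Γ' → ⟦ B ⟧Ty Γ'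
⟦ □ A ⟧Ty   Γ = ∀ Γ' → Γ ⊆ Γ' → ∀ Δ → Γ' ◁ Δ → ⟦ A ⟧Ty Δ

⟦_⟧Ctx : Ctx → Ctx → Set
⟦ [] ⟧Ctx     w = ⊤
⟦ Γ `, A ⟧Ctx w = ⟦ Γ ⟧Ctx w × ⟦ A ⟧Ty w
⟦ Γ ,🔒 ⟧Ctx  w = Σ Ctx (λ u → ⟦ Γ ⟧Ctx u × (u ◁ w))

M : Ctx → Ty → Set
M Γ A = ∀ w → ⟦ Γ ⟧Ctx w → ⟦ A ⟧Ty w

wkTy : ∀ A {w w'} → w ⊆ w' → ⟦ A ⟧Ty w → ⟦ A ⟧Ty w'
wkTy ι       o n = wkNe o n
wkTy (A ⇒ B) o f = λ w'' o' a → f w'' (o ∙ o') a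
wkTy (□ A)   o f = λ w'' o' v e → f w'' (o ∙ o') v e

wkCtx : ∀ Γ {w w'} → w ⊆ w' → ⟦ Γ ⟧Ctx w → ⟦ Γ ⟧Ctx w'
wkCtx []       o γ = tt
wkCtx (Γ `, A) o (γ , a) = wkCtx Γ o γ , wkTy A o a
wkCtx (Γ ,🔒)  o (u , γ , e) with factor e o
... | u' , o' , e' = u' , wkCtx Γ o' γ , e'

lookupVar : Var Γ A → ∀ {w} → ⟦ Γ ⟧Ctx w → ⟦ A ⟧Ty w
lookupVar ze     (γ , a) = a
lookupVar (su x) (γ , a) = lookupVar x γ

unlock : Δ ◁ Γ → ∀ {w} → ⟦ Γ ⟧Ctx w → Σ Ctx (λ u → ⟦ Δ ⟧Ctx u × (u ◁ w))
unlock nil     γ       = γ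
unlock (ext e) (γ , a) = unlock e γ

eval : Tm Γ A → M Γ A
eval (var x)     w γ = lookupVar x γ
eval {Γ} (lam t) w γ = λ w' o a → eval t w' (wkCtx Γ o γ , a)
eval (app t u)   w γ = eval t w γ w ⊆-refl (eval u w γ)
eval {Γ} (box t) w γ = λ w' o v e → eval t v (w' , wkCtx Γ o γ , e)
eval (unbox t e) w γ with unlock e γ
... | u , δ , e' = eval t u δ u ⊆-refl w e'

-- Normalisation by evaluation in the Kripke model whose worlds are contexts. Reflection and
-- reification, defined by recursion on types, turn neutrals into values and values into normal
-- forms; quote reifies a value computed in the reflected identity environment.
--
-- Adequacy: a Kripke logical relation between terms and values, closed under weakening and
-- conversion, relates every term under a related substitution to its value, and reification of
-- related values yields convertible normal forms; at the identity substitution this gives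
-- t ≈ quote ⟦t⟧.
--
-- Completeness: semantic functions are neither extensional nor natural, so values are compared by
-- a Kripke partial equivalence demanding pointwise agreement and commutation with weakening.
-- Evaluation respects it, convertible terms evaluate to equivalent values, and reification
-- sends equivalent values to equal normal forms.
--
-- Throughout, the modal cases rest on factorising an accessibility Δ ◁ Γ along an embedding of Γ
-- or a substitution into Γ, and on its semantic counterpart unlock.

{-# OPTIONS --safe #-}
module Submission where

open import Defs
open import Data.Unit using (tt)
open import Data.Product using (Σ; _×_; _,_; proj₁; proj₂)
open import Relation.Binary.PropositionalEquality
  using (_≡_; refl; sym; trans; cong; cong₂; module ≡-Reasoning)
  renaming (subst to transport)

private
  variable
    Γ Γ' Γ'' Γ''' Δ Δ' Θ Θ' w w' : Ctx
    A B : Ty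

-- Embeddings and factorisation of accessibility

∙-identityˡ : (o : Γ ⊆ Γ') → ⊆-refl ∙ o ≡ o
∙-identityˡ base       = refl
∙-identityˡ (drop o)   = cong drop (∙-identityˡ o)
∙-identityˡ (keep o)   = cong keep (∙-identityˡ o)
∙-identityˡ (keep🔒 o) = cong keep🔒 (∙-identityˡ o)

∙-identityʳ : (o : Γ ⊆ Γ') → o ∙ ⊆-refl ≡ o
∙-identityʳ base       = refl
∙-identityʳ (drop o)   = cong drop (∙-identityʳ o)
∙-identityʳ (keep o)   = cong keep (∙-identityʳ o)
∙-identityʳ (keep🔒 o) = cong keep🔒 (∙-identityʳ o)

⊆-refl-central : (o : Γ ⊆ Γ') → ⊆-refl ∙ o ≡ o ∙ ⊆-refl
⊆-refl-central o = trans (∙-identityˡ o) (sym (∙-identityʳ o))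

∙-assoc : (o₁ : Γ ⊆ Γ') (o₂ : Γ' ⊆ Γ'') (o₃ : Γ'' ⊆ Γ''') → (o₁ ∙ o₂) ∙ o₃ ≡ o₁ ∙ (o₂ ∙ o₃)
∙-assoc o₁          o₂          (drop o₃)   = cong drop (∙-assoc o₁ o₂ o₃)
∙-assoc base        base        base        = refl
∙-assoc o₁          (drop o₂)   (keep o₃)   = cong drop (∙-assoc o₁ o₂ o₃)
∙-assoc (drop o₁)   (keep o₂)   (keep o₃)   = cong drop (∙-assoc o₁ o₂ o₃)
∙-assoc (keep o₁)   (keep o₂)   (keep o₃)   = cong keep (∙-assoc o₁ o₂ o₃)
∙-assoc (keep🔒 o₁) (keep🔒 o₂) (keep🔒 o₃) = cong keep🔒 (∙-assoc o₁ o₂ o₃)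

Factorisation : Ctx → Ctx → Set
Factorisation Δ Γ = Σ Ctx (λ Δ' → (Δ ⊆ Δ') × (Δ' ◁ Γ))

extᶠ : Factorisation Δ Γ → Factorisation Δ (Γ `, A)
extᶠ (Δ' , o , e) = Δ' , o , ext e

_∙ᶠ_ : Factorisation Δ Γ → Γ ⊆ Γ' → Factorisation Δ Γ'
(_ , o , e) ∙ᶠ o' = let (Δ' , o'' , e') = factor e o' in Δ' , o ∙ o'' , e'

factor-drop : (e : Δ ◁ Γ) (o : Γ ⊆ Γ') → factor e (drop {A = A} o) ≡ extᶠ (factor e o)
factor-drop nil     o = refl
factor-drop (ext e) o = refl

∙ᶠ-drop : (F : Factorisation Δ Γ) (o : Γ ⊆ Γ') → F ∙ᶠ drop {A = A} o ≡ extᶠ (F ∙ᶠ o)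
∙ᶠ-drop (_ , o , e) o' = cong (λ (Δ' , o'' , e') → Δ' , o ∙ o'' , e') (factor-drop e o')

factor-⊆-refl : (e : Δ ◁ Γ) → factor e ⊆-refl ≡ (Δ , ⊆-refl , e)
factor-⊆-refl nil     = refl
factor-⊆-refl (ext e) = cong extᶠ (factor-⊆-refl e)

factor-∙ : (e : Δ ◁ Γ) (o : Γ ⊆ Γ') (o' : Γ' ⊆ Γ'') → factor e (o ∙ o') ≡ factor e o ∙ᶠ o'
factor-∙ e       o          (drop o')   = trans (factor-drop e (o ∙ o'))
  (trans (cong extᶠ (factor-∙ e o o')) (sym (∙ᶠ-drop (factor e o) o')))
factor-∙ ()      base       base
factor-∙ nil     (drop o)   (keep o')   = cong extᶠ (factor-∙ nil o o')
factor-∙ nil     (keep🔒 o) (keep🔒 o') = refl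
factor-∙ (ext e) (drop o)   (keep o')   = cong extᶠ (factor-∙ (ext e) o o')
factor-∙ (ext e) (keep o)   (keep o')   = cong extᶠ (factor-∙ e o o')

◁⇒⊆-factor : (e : Δ ◁ Γ) (o : Γ ⊆ Γ') →
  ◁⇒⊆ e ∙ o ≡ (let (_ , o' , e') = factor e o in keep🔒 o' ∙ ◁⇒⊆ e')
◁⇒⊆-factor nil     (drop o)   = cong drop (◁⇒⊆-factor nil o)
◁⇒⊆-factor nil     (keep🔒 o) = cong keep🔒 (⊆-refl-central o)
◁⇒⊆-factor (ext e) (drop o)   = cong drop (◁⇒⊆-factor (ext e) o)
◁⇒⊆-factor (ext e) (keep o)   = cong drop (◁⇒⊆-factor e o)

factor-nil-◁⇒⊆ : (o : Δ ⊆ Δ') (e : Δ' ◁ Γ) → factor nil (keep🔒 o ∙ ◁⇒⊆ e) ≡ (Δ' , o , e)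
factor-nil-◁⇒⊆ o nil     = cong (λ o' → _ , o' , nil) (∙-identityʳ o)
factor-nil-◁⇒⊆ o (ext e) = cong extᶠ (factor-nil-◁⇒⊆ o e)

-- Weakening

wkVar-id : (x : Var Γ A) → wkVar ⊆-refl x ≡ x
wkVar-id ze     = refl
wkVar-id (su x) = cong su (wkVar-id x)

wkVar-∙ : (o : Γ ⊆ Γ') (o' : Γ' ⊆ Γ'') (x : Var Γ A) → wkVar o' (wkVar o x) ≡ wkVar (o ∙ o') x
wkVar-∙ o          (drop o')   x      = cong su (wkVar-∙ o o' x)
wkVar-∙ (drop o)   (keep o')   x      = cong su (wkVar-∙ o o' x)
wkVar-∙ base       base        ()
wkVar-∙ (keep🔒 o) (keep🔒 o') ()
wkVar-∙ (keep o)   (keep o')   ze     = refl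
wkVar-∙ (keep o)   (keep o')   (su x) = cong su (wkVar-∙ o o' x)

unboxᶠ : Tm Δ (□ A) → Factorisation Δ Γ → Tm Γ A
unboxᶠ t (_ , o , e) = unbox (wkTm o t) e

wkTm-id : (t : Tm Γ A) → wkTm ⊆-refl t ≡ t
wkTm-id (var x)     = cong var (wkVar-id x)
wkTm-id (lam t)     = cong lam (wkTm-id t)
wkTm-id (app t u)   = cong₂ app (wkTm-id t) (wkTm-id u)
wkTm-id (box t)     = cong box (wkTm-id t)
wkTm-id (unbox t e) = trans (cong (unboxᶠ t) (factor-⊆-refl e)) (cong (λ t → unbox t e) (wkTm-id t))

wkTm-∙ : (o : Γ ⊆ Γ') (o' : Γ' ⊆ Γ'') (t : Tm Γ A) → wkTm o' (wkTm o t) ≡ wkTm (o ∙ o') t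
wkTm-∙ o o' (var x)     = cong var (wkVar-∙ o o' x)
wkTm-∙ o o' (lam t)     = cong lam (wkTm-∙ (keep o) (keep o') t)
wkTm-∙ o o' (app t u)   = cong₂ app (wkTm-∙ o o' t) (wkTm-∙ o o' u)
wkTm-∙ o o' (box t)     = cong box (wkTm-∙ (keep🔒 o) (keep🔒 o') t)
wkTm-∙ o o' (unbox t e) = trans (cong (λ t' → unbox t' _) (wkTm-∙ _ _ t)) (cong (unboxᶠ t) (sym (factor-∙ e o o')))

unboxNeᶠ : Ne Δ (□ A) → Factorisation Δ Γ → Ne Γ A
unboxNeᶠ n (_ , o , e) = unbox (wkNe o n) e

wkNe-id : (n : Ne Γ A) → wkNe ⊆-refl n ≡ n
wkNf-id : (m : Nf Γ A) → wkNf ⊆-refl m ≡ m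
wkNe-id (var x)     = cong var (wkVar-id x)
wkNe-id (app n m)   = cong₂ app (wkNe-id n) (wkNf-id m)
wkNe-id (unbox n e) = trans (cong (unboxNeᶠ n) (factor-⊆-refl e)) (cong (λ n → unbox n e) (wkNe-id n))
wkNf-id (up n)  = cong up (wkNe-id n)
wkNf-id (lam m) = cong lam (wkNf-id m)
wkNf-id (box m) = cong box (wkNf-id m)

wkNe-∙ : (o : Γ ⊆ Γ') (o' : Γ' ⊆ Γ'') (n : Ne Γ A) → wkNe o' (wkNe o n) ≡ wkNe (o ∙ o') n
wkNf-∙ : (o : Γ ⊆ Γ') (o' : Γ' ⊆ Γ'') (m : Nf Γ A) → wkNf o' (wkNf o m) ≡ wkNf (o ∙ o') m
wkNe-∙ o o' (var x)     = cong var (wkVar-∙ o o' x)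
wkNe-∙ o o' (app n m)   = cong₂ app (wkNe-∙ o o' n) (wkNf-∙ o o' m)
wkNe-∙ o o' (unbox n e) = trans (cong (λ n' → unbox n' _) (wkNe-∙ _ _ n)) (cong (unboxNeᶠ n) (sym (factor-∙ e o o')))
wkNf-∙ o o' (up n)  = cong up (wkNe-∙ o o' n)
wkNf-∙ o o' (lam m) = cong lam (wkNf-∙ (keep o) (keep o') m)
wkNf-∙ o o' (box m) = cong box (wkNf-∙ (keep🔒 o) (keep🔒 o') m)

embNe-wk : (o : Γ ⊆ Γ') (n : Ne Γ A) → wkTm o (embNe n) ≡ embNe (wkNe o n)
embNf-wk : (o : Γ ⊆ Γ') (m : Nf Γ A) → wkTm o (embNf m) ≡ embNf (wkNf o m)
embNe-wk o (var x)     = refl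
embNe-wk o (app n m)   = cong₂ app (embNe-wk o n) (embNf-wk o m)
embNe-wk o (unbox n e) = cong (λ t → unbox t _) (embNe-wk _ n)
embNf-wk o (up n)  = embNe-wk o n
embNf-wk o (lam m) = cong lam (embNf-wk (keep o) m)
embNf-wk o (box m) = cong box (embNf-wk (keep🔒 o) m)

-- Substitution

infixl 5 _↾_ _⊙_

_↾_ : Sub Θ Δ → Γ ⊆ Δ → Sub Θ Γ
[]       ↾ base     = []
(s `, t) ↾ drop o   = s ↾ o
(s `, t) ↾ keep o   = (s ↾ o) `, t
lock s e ↾ keep🔒 o = lock (s ↾ o) e

SubFactorisation : Ctx → Ctx → Set
SubFactorisation Δ Γ = Σ Ctx (λ Γ' → Sub Γ' Δ × (Γ' ◁ Γ))

_⊙_ : Sub Θ Γ → Sub Γ Δ → Sub Θ Δ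
s ⊙ []         = []
s ⊙ (s' `, t)  = (s ⊙ s') `, subst s t
s ⊙ lock s' e  = let (_ , s₀ , e₀) = factorSub e s in lock (s₀ ⊙ s') e₀

lockᶠ : Sub Γ Δ → Factorisation Γ Θ → Sub Θ (Δ ,🔒)
lockᶠ s (_ , o , e) = lock (wkSub o s) e

lockˢ : Sub Γ Δ → SubFactorisation Γ Θ → Sub Θ (Δ ,🔒)
lockˢ s (_ , s₀ , e) = lock (s₀ ⊙ s) e

unboxˢ : Tm Δ (□ A) → SubFactorisation Δ Γ → Tm Γ A
unboxˢ t (_ , s , e) = unbox (subst s t) e

wkSub-id : (s : Sub Γ Δ) → wkSub ⊆-refl s ≡ s
wkSub-id []         = refl
wkSub-id (s `, t)   = cong₂ _`,_ (wkSub-id s) (wkTm-id t)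
wkSub-id (lock s e) = trans (cong (lockᶠ s) (factor-⊆-refl e)) (cong (λ s → lock s e) (wkSub-id s))

wkSub-∙ : (o : Γ ⊆ Γ') (o' : Γ' ⊆ Γ'') (s : Sub Γ Δ) → wkSub o' (wkSub o s) ≡ wkSub (o ∙ o') s
wkSub-∙ o o' []         = refl
wkSub-∙ o o' (s `, t)   = cong₂ _`,_ (wkSub-∙ o o' s) (wkTm-∙ o o' t)
wkSub-∙ o o' (lock s e) = trans (cong (λ s' → lock s' _) (wkSub-∙ _ _ s)) (cong (lockᶠ s) (sym (factor-∙ e o o')))

factorSub-wkSub : (e : Δ' ◁ Δ) (o : Γ ⊆ Γ') (s : Sub Γ Δ) →
  factorSub e (wkSub o s) ≡
    (let (_ , s₀ , e₀) = factorSub e s ; (Γ₁ , o₁ , e₁) = factor e₀ o in Γ₁ , wkSub o₁ s₀ , e₁)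
factorSub-wkSub nil     o (lock s e) = refl
factorSub-wkSub (ext e) o (s `, t)   = factorSub-wkSub e o s

factorSub-↾ : (e : Δ' ◁ Γ) (o : Γ ⊆ Δ) (s : Sub Θ Δ) →
  factorSub e (s ↾ o) ≡
    (let (_ , o₀ , e₀) = factor e o ; (Θ₁ , s₁ , e₁) = factorSub e₀ s in Θ₁ , s₁ ↾ o₀ , e₁)
factorSub-↾ nil     (keep🔒 o) (lock s e) = refl
factorSub-↾ nil     (drop o)   (s `, t)   = factorSub-↾ nil o s
factorSub-↾ (ext e) (drop o)   (s `, t)   = factorSub-↾ (ext e) o s
factorSub-↾ (ext e) (keep o)   (s `, t)   = factorSub-↾ e o s

factorSub-⊙ : (e : Δ' ◁ Δ) (s : Sub Θ Γ) (s' : Sub Γ Δ) →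
  factorSub e (s ⊙ s') ≡
    (let (_ , s₀ , e₀) = factorSub e s' ; (Θ₁ , s₁ , e₁) = factorSub e₀ s in Θ₁ , s₁ ⊙ s₀ , e₁)
factorSub-⊙ nil     s (lock s' e) = refl
factorSub-⊙ (ext e) s (s' `, t)   = factorSub-⊙ e s s'

factorSub-idSub : (e : Δ ◁ Γ) → factorSub e (idSub {Γ}) ≡ (Δ , idSub , e)
factorSub-idSub nil = refl
factorSub-idSub {Δ} (ext {A = A} e) = begin
  factorSub e (wkSub (drop ⊆-refl) idSub)
    ≡⟨ factorSub-wkSub e (drop ⊆-refl) idSub ⟩
  (let (_ , s₀ , e₀) = factorSub e idSub ; (Γ₁ , o₁ , e₁) = factor e₀ (drop {A = A} ⊆-refl)
   in Γ₁ , wkSub o₁ s₀ , e₁)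
    ≡⟨ cong (λ (_ , s₀ , e₀) → let (Γ₁ , o₁ , e₁) = factor e₀ (drop {A = A} ⊆-refl) in Γ₁ , wkSub o₁ s₀ , e₁)
            (factorSub-idSub e) ⟩
  (let (Γ₁ , o₁ , e₁) = factor e (drop {A = A} ⊆-refl) in Γ₁ , wkSub o₁ idSub , e₁)
    ≡⟨ cong (λ (Γ₁ , o₁ , e₁) → Γ₁ , wkSub o₁ idSub , e₁)
            (trans (factor-drop e ⊆-refl) (cong extᶠ (factor-⊆-refl e))) ⟩
  (Δ , wkSub ⊆-refl idSub , ext e)
    ≡⟨ cong (λ s → Δ , s , ext e) (wkSub-id idSub) ⟩
  (Δ , idSub , ext e) ∎
  where open ≡-Reasoning

↾-⊆-refl : (s : Sub Θ Δ) → s ↾ ⊆-refl ≡ s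
↾-⊆-refl []         = refl
↾-⊆-refl (s `, t)   = cong (_`, t) (↾-⊆-refl s)
↾-⊆-refl (lock s e) = cong (λ s → lock s e) (↾-⊆-refl s)

wkSub-↾ : (o : Θ ⊆ Θ') (s : Sub Θ Δ) (o' : Γ ⊆ Δ) → wkSub o (s ↾ o') ≡ wkSub o s ↾ o'
wkSub-↾ o []         base        = refl
wkSub-↾ o (s `, t)   (drop o')   = wkSub-↾ o s o'
wkSub-↾ o (s `, t)   (keep o')   = cong (_`, _) (wkSub-↾ o s o')
wkSub-↾ o (lock s e) (keep🔒 o') = cong (λ s → lock s _) (wkSub-↾ _ s o')

substVar-wkVar : (s : Sub Θ Δ) (o : Γ ⊆ Δ) (x : Var Γ A) → substVar s (wkVar o x) ≡ substVar (s ↾ o) x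
substVar-wkVar (s `, t) (drop o) x      = substVar-wkVar s o x
substVar-wkVar (s `, t) (keep o) ze     = refl
substVar-wkVar (s `, t) (keep o) (su x) = substVar-wkVar s o x

wkTm-substVar : (o : Θ ⊆ Θ') (s : Sub Θ Δ) (x : Var Δ A) → wkTm o (substVar s x) ≡ substVar (wkSub o s) x
wkTm-substVar o (s `, t) ze     = refl
wkTm-substVar o (s `, t) (su x) = wkTm-substVar o s x

wkSub-keep-drop : (o : Θ ⊆ Θ') (s : Sub Θ Δ) →
  wkSub (keep {A = A} o) (wkSub (drop ⊆-refl) s) ≡ wkSub (drop ⊆-refl) (wkSub o s)
wkSub-keep-drop o s = trans (wkSub-∙ _ _ s)
  (trans (cong (λ o' → wkSub (drop o') s) (⊆-refl-central o)) (sym (wkSub-∙ _ _ s)))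

wkTm-subst : (o : Θ ⊆ Θ') (s : Sub Θ Δ) (t : Tm Δ A) → wkTm o (subst s t) ≡ subst (wkSub o s) t
wkTm-subst o s (var x)     = wkTm-substVar o s x
wkTm-subst o s (lam t)     = cong lam (trans (wkTm-subst (keep o) _ t)
  (cong (λ s' → subst (s' `, var ze) t) (wkSub-keep-drop o s)))
wkTm-subst o s (app t u)   = cong₂ app (wkTm-subst o s t) (wkTm-subst o s u)
wkTm-subst o s (box t)     = cong box (wkTm-subst (keep🔒 o) (lock s nil) t)
wkTm-subst o s (unbox t e) = trans (cong (λ t' → unbox t' _) (wkTm-subst _ _ t))
  (cong (unboxˢ t) (sym (factorSub-wkSub e o s)))

subst-wkTm : (s : Sub Θ Δ) (o : Γ ⊆ Δ) (t : Tm Γ A) → subst s (wkTm o t) ≡ subst (s ↾ o) t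
subst-wkTm s o (var x)     = substVar-wkVar s o x
subst-wkTm s o (lam t)     = cong lam (trans (subst-wkTm _ (keep o) t)
  (cong (λ s' → subst (s' `, var ze) t) (sym (wkSub-↾ _ s o))))
subst-wkTm s o (app t u)   = cong₂ app (subst-wkTm s o t) (subst-wkTm s o u)
subst-wkTm s o (box t)     = cong box (subst-wkTm (lock s nil) (keep🔒 o) t)
subst-wkTm s o (unbox t e) = trans (cong (λ t' → unbox t' _) (subst-wkTm _ _ t))
  (cong (unboxˢ t) (sym (factorSub-↾ e o s)))

wkSub-⊙ : (o : Θ ⊆ Θ') (s : Sub Θ Γ) (s' : Sub Γ Δ) → wkSub o (s ⊙ s') ≡ wkSub o s ⊙ s'
wkSub-⊙ o s []          = refl
wkSub-⊙ o s (s' `, t)   = cong₂ _`,_ (wkSub-⊙ o s s') (wkTm-subst o s t)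
wkSub-⊙ o s (lock s' e) = trans (cong (λ s₀ → lock s₀ _) (wkSub-⊙ _ _ s'))
  (cong (lockˢ s') (sym (factorSub-wkSub e o s)))

⊙-wkSub : (s : Sub Θ Γ') (o : Γ ⊆ Γ') (s' : Sub Γ Δ) → s ⊙ wkSub o s' ≡ (s ↾ o) ⊙ s'
⊙-wkSub s o []          = refl
⊙-wkSub s o (s' `, t)   = cong₂ _`,_ (⊙-wkSub s o s') (subst-wkTm s o t)
⊙-wkSub s o (lock s' e) = trans (cong (λ s₀ → lock s₀ _) (⊙-wkSub _ _ s'))
  (cong (lockˢ s') (sym (factorSub-↾ e o s)))

subst-substVar : (s : Sub Θ Γ) (s' : Sub Γ Δ) (x : Var Δ A) → subst s (substVar s' x) ≡ substVar (s ⊙ s') x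
subst-substVar s (s' `, t) ze     = refl
subst-substVar s (s' `, t) (su x) = subst-substVar s s' x

lift-⊙ : (s : Sub Θ Γ) (s' : Sub Γ Δ) →
  (wkSub (drop {A = A} ⊆-refl) s `, var ze) ⊙ wkSub (drop ⊆-refl) s' ≡ wkSub (drop ⊆-refl) (s ⊙ s')
lift-⊙ s s' = trans (⊙-wkSub _ (drop ⊆-refl) s')
  (trans (cong (_⊙ s') (↾-⊆-refl _)) (sym (wkSub-⊙ _ s s')))

subst-subst : (s : Sub Θ Γ) (s' : Sub Γ Δ) (t : Tm Δ A) → subst s (subst s' t) ≡ subst (s ⊙ s') t
subst-subst s s' (var x)     = subst-substVar s s' x
subst-subst s s' (lam t)     = cong lam (trans (subst-subst _ _ t)
  (cong (λ s₀ → subst (s₀ `, var ze) t) (lift-⊙ s s')))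
subst-subst s s' (app t u)   = cong₂ app (subst-subst s s' t) (subst-subst s s' u)
subst-subst s s' (box t)     = cong box (subst-subst (lock s nil) (lock s' nil) t)
subst-subst s s' (unbox t e) = trans (cong (λ t' → unbox t' _) (subst-subst _ _ t))
  (cong (unboxˢ t) (sym (factorSub-⊙ e s s')))

substVar-idSub : (x : Var Γ A) → substVar idSub x ≡ var x
substVar-idSub ze     = refl
substVar-idSub (su x) = trans (sym (wkTm-substVar (drop ⊆-refl) idSub x))
  (trans (cong (wkTm (drop ⊆-refl)) (substVar-idSub x)) (cong (λ y → var (su y)) (wkVar-id x)))

subst-idSub : (t : Tm Γ A) → subst idSub t ≡ t
subst-idSub (var x)     = substVar-idSub x
subst-idSub (lam t)     = cong lam (subst-idSub t)
subst-idSub (app t u)   = cong₂ app (subst-idSub t) (subst-idSub u)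
subst-idSub (box t)     = cong box (subst-idSub t)
subst-idSub (unbox t e) = trans (cong (unboxˢ t) (factorSub-idSub e)) (cong (λ t → unbox t e) (subst-idSub t))

⊙-identityʳ : (s : Sub Θ Γ) → s ⊙ idSub ≡ s
⊙-identityʳ {Γ = []}     []         = refl
⊙-identityʳ {Γ = Γ `, A} (s `, t)   = cong (_`, t) (trans (⊙-wkSub (s `, t) (drop ⊆-refl) idSub)
  (trans (cong (_⊙ idSub) (↾-⊆-refl s)) (⊙-identityʳ s)))
⊙-identityʳ {Γ = Γ ,🔒}  (lock s e) = cong (λ s → lock s e) (⊙-identityʳ s)

idSub↾-⊙ : (o : Γ ⊆ Γ') (s : Sub Γ Δ) → (idSub ↾ o) ⊙ s ≡ wkSub o s
idSub↾-⊙ o []         = refl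
idSub↾-⊙ o (s `, t)   = cong₂ _`,_ (idSub↾-⊙ o s) (trans (sym (subst-wkTm idSub o t)) (subst-idSub (wkTm o t)))
idSub↾-⊙ o (lock s e) = trans
  (cong (lockˢ s) (trans (factorSub-↾ e o idSub)
    (cong (λ (Θ₁ , s₁ , e₁) → Θ₁ , s₁ ↾ proj₁ (proj₂ (factor e o)) , e₁)
          (factorSub-idSub (proj₂ (proj₂ (factor e o)))))))
  (cong (λ s' → lock s' _) (idSub↾-⊙ _ s))

wkSub-idSub : (o : Γ ⊆ Γ') → wkSub o idSub ≡ idSub ↾ o
wkSub-idSub o = trans (sym (idSub↾-⊙ o idSub)) (⊙-identityʳ _)

≡⇒≈ : {t u : Tm Γ A} → t ≡ u → t ≈ u
≡⇒≈ refl = ≈-refl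

wkTm-≈ : (o : Γ ⊆ Γ') {t u : Tm Γ A} → t ≈ u → wkTm o t ≈ wkTm o u
wkTm-≈ o ≈-refl         = ≈-refl
wkTm-≈ o (≈-sym p)      = ≈-sym (wkTm-≈ o p)
wkTm-≈ o (≈-trans p q)  = ≈-trans (wkTm-≈ o p) (wkTm-≈ o q)
wkTm-≈ o (cong-lam p)   = cong-lam (wkTm-≈ (keep o) p)
wkTm-≈ o (cong-app p q) = cong-app (wkTm-≈ o p) (wkTm-≈ o q)
wkTm-≈ o (cong-box p)   = cong-box (wkTm-≈ (keep🔒 o) p)
wkTm-≈ o (cong-unbox p) = cong-unbox (wkTm-≈ _ p)
wkTm-≈ o (⇒-β t u) = ≈-trans (⇒-β (wkTm (keep o) t) (wkTm o u)) (≡⇒≈ (begin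
  subst (idSub `, wkTm o u) (wkTm (keep o) t)   ≡⟨ subst-wkTm _ (keep o) t ⟩
  subst ((idSub ↾ o) `, wkTm o u) t             ≡⟨ cong (λ s → subst (s `, wkTm o u) t) (sym (wkSub-idSub o)) ⟩
  subst (wkSub o idSub `, wkTm o u) t           ≡⟨ sym (wkTm-subst o _ t) ⟩
  wkTm o (subst (idSub `, u) t)                 ∎))
  where open ≡-Reasoning
wkTm-≈ o (⇒-η t) = ≈-trans (⇒-η (wkTm o t)) (≡⇒≈ (cong (λ t' → lam (app t' (var ze))) (begin
  wkTm (drop ⊆-refl) (wkTm o t)   ≡⟨ wkTm-∙ o _ t ⟩
  wkTm (drop (o ∙ ⊆-refl)) t      ≡⟨ cong (λ o' → wkTm (drop o') t) (sym (⊆-refl-central o)) ⟩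
  wkTm (drop (⊆-refl ∙ o)) t      ≡⟨ sym (wkTm-∙ _ (keep o) t) ⟩
  wkTm (keep o) (wkTm (drop ⊆-refl) t) ∎)))
  where open ≡-Reasoning
wkTm-≈ o (□-β t e) = ≈-trans (□-β _ _)
  (≡⇒≈ (trans (wkTm-∙ _ _ t) (trans (cong (λ o' → wkTm o' t) (sym (◁⇒⊆-factor e o))) (sym (wkTm-∙ _ _ t)))))
wkTm-≈ o (□-η t) = □-η (wkTm o t)

-- Reflection and reification

reflect : ∀ A → Ne Γ A → ⟦ A ⟧Ty Γ
reify   : ∀ A → ⟦ A ⟧Ty Γ → Nf Γ A
reflect ι       n = n
reflect (A ⇒ B) n = λ _ o a → reflect B (app (wkNe o n) (reify A a))
reflect (□ A)   n = λ _ o _ e → reflect A (unbox (wkNe o n) e)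
reify ι       n = up n
reify (A ⇒ B) f = lam (reify B (f _ (drop ⊆-refl) (reflect A (var ze))))
reify (□ A)   f = box (reify A (f _ ⊆-refl _ nil))

reflectCtx : ∀ Γ → ⟦ Γ ⟧Ctx Γ
reflectCtx []       = tt
reflectCtx (Γ `, A) = wkCtx Γ (drop ⊆-refl) (reflectCtx Γ) , reflect A (var ze)
reflectCtx (Γ ,🔒)  = Γ , reflectCtx Γ , nil

quoteᴹ : M Γ A → Nf Γ A
quoteᴹ {Γ} {A} f = reify A (f Γ (reflectCtx Γ))

-- Adequacy

Related : ∀ A → Tm Γ A → ⟦ A ⟧Ty Γ → Set
Related ι       t n = t ≈ embNe n
Related (A ⇒ B) t f = ∀ Γ' (o : _ ⊆ Γ') u a → Related A u a → Related B (app (wkTm o t) u) (f Γ' o a)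
Related (□ A)   t f = ∀ Γ' (o : _ ⊆ Γ') Δ (e : Γ' ◁ Δ) → Related A (unbox (wkTm o t) e) (f Γ' o Δ e)

Related-≈ : ∀ A {t t' : Tm Γ A} {a} → t ≈ t' → Related A t a → Related A t' a
Related-≈ ι       p r = ≈-trans (≈-sym p) r
Related-≈ (A ⇒ B) p r = λ Γ' o u a q → Related-≈ B (cong-app (wkTm-≈ o p) ≈-refl) (r Γ' o u a q)
Related-≈ (□ A)   p r = λ Γ' o Δ e → Related-≈ A (cong-unbox (wkTm-≈ o p)) (r Γ' o Δ e)

Related-≡ : ∀ A {t t' : Tm Γ A} {a} → t ≡ t' → Related A t a → Related A t' a
Related-≡ A refl r = r

Related-wk : ∀ A (o : Γ ⊆ Γ') {t a} → Related A t a → Related A (wkTm o t) (wkTy A o a)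
Related-wk ι       o r = ≈-trans (wkTm-≈ o r) (≡⇒≈ (embNe-wk o _))
Related-wk (A ⇒ B) o {t} r = λ Γ' o' u a q →
  Related-≡ B (cong (λ t' → app t' u) (sym (wkTm-∙ o o' t))) (r Γ' (o ∙ o') u a q)
Related-wk (□ A)   o {t} r = λ Γ' o' Δ e →
  Related-≡ A (cong (λ t' → unbox t' e) (sym (wkTm-∙ o o' t))) (r Γ' (o ∙ o') Δ e)

reflect-Related : ∀ A {t : Tm Γ A} (n : Ne Γ A) → t ≈ embNe n → Related A t (reflect A n)
reify-Related   : ∀ A {t : Tm Γ A} a → Related A t a → t ≈ embNf (reify A a)
reflect-Related ι       n p = p
reflect-Related (A ⇒ B) n p = λ Γ' o u a q →
  reflect-Related B _ (cong-app (≈-trans (wkTm-≈ o p) (≡⇒≈ (embNe-wk o n))) (reify-Related A a q))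
reflect-Related (□ A)   n p = λ Γ' o Δ e →
  reflect-Related A _ (cong-unbox (≈-trans (wkTm-≈ o p) (≡⇒≈ (embNe-wk o n))))
reify-Related ι       a r = r
reify-Related (A ⇒ B) f r = ≈-trans (⇒-η _)
  (cong-lam (reify-Related B _ (r _ (drop ⊆-refl) (var ze) _ (reflect-Related A (var ze) ≈-refl))))
reify-Related (□ A) {t} f r = ≈-trans (□-η t)
  (cong-box (reify-Related A _ (Related-≡ A (cong (λ t' → unbox t' nil) (wkTm-id t)) (r _ ⊆-refl _ nil))))

data RelatedSub : Sub Θ Γ → ⟦ Γ ⟧Ctx Θ → Set where
  []ᴿ   : RelatedSub {Θ} [] tt
  _,ᴿ_  : {s : Sub Θ Γ} {γ : ⟦ Γ ⟧Ctx Θ} {t : Tm Θ A} {a : ⟦ A ⟧Ty Θ} →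
          RelatedSub s γ → Related A t a → RelatedSub (s `, t) (γ , a)
  lockᴿ : {s : Sub Θ' Γ} {γ : ⟦ Γ ⟧Ctx Θ'} {e : Θ' ◁ Θ} →
          RelatedSub s γ → RelatedSub (lock s e) (Θ' , γ , e)

RelatedSub-wk : (o : Θ ⊆ Θ') {s : Sub Θ Γ} {γ : ⟦ Γ ⟧Ctx Θ} → RelatedSub s γ → RelatedSub (wkSub o s) (wkCtx Γ o γ)
RelatedSub-wk o []ᴿ       = []ᴿ
RelatedSub-wk o (p ,ᴿ r)  = RelatedSub-wk o p ,ᴿ Related-wk _ o r
RelatedSub-wk o (lockᴿ p) = lockᴿ (RelatedSub-wk _ p)

RelatedSub-lookup : (x : Var Γ A) {s : Sub Θ Γ} {γ : ⟦ Γ ⟧Ctx Θ} →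
  RelatedSub s γ → Related A (substVar s x) (lookupVar x γ)
RelatedSub-lookup ze     (p ,ᴿ r) = r
RelatedSub-lookup (su x) (p ,ᴿ r) = RelatedSub-lookup x p

RelatedSub-idSub : ∀ Γ → RelatedSub (idSub {Γ}) (reflectCtx Γ)
RelatedSub-idSub []       = []ᴿ
RelatedSub-idSub (Γ `, A) = RelatedSub-wk (drop ⊆-refl) (RelatedSub-idSub Γ) ,ᴿ reflect-Related A (var ze) ≈-refl
RelatedSub-idSub (Γ ,🔒)  = lockᴿ (RelatedSub-idSub Γ)

-- An inductive relation, so that matching on it exposes the common world and accessibility.
data RelatedLocked : SubFactorisation Δ Γ → ⟦ Δ ,🔒 ⟧Ctx Γ → Set where
  mkᴿ : {s : Sub Θ Δ} {γ : ⟦ Δ ⟧Ctx Θ} {e : Θ ◁ Γ} → RelatedSub s γ → RelatedLocked (Θ , s , e) (Θ , γ , e)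

RelatedSub-unlock : (e : Δ ◁ Γ) {s : Sub Θ Γ} {γ : ⟦ Γ ⟧Ctx Θ} → RelatedSub s γ → RelatedLocked (factorSub e s) (unlock e γ)
RelatedSub-unlock nil     (lockᴿ p) = mkᴿ p
RelatedSub-unlock (ext e) (p ,ᴿ r)  = RelatedSub-unlock e p

subst-lam-β : (o : Θ ⊆ Θ') (s : Sub Θ Γ) (t : Tm (Γ `, A) B) (u : Tm Θ' A) →
  subst (idSub `, u) (wkTm (keep o) (subst (wkSub (drop ⊆-refl) s `, var ze) t)) ≡ subst (wkSub o s `, u) t
subst-lam-β o s t u = begin
  subst (idSub `, u) (wkTm (keep o) (subst (wkSub (drop ⊆-refl) s `, var ze) t))
    ≡⟨ subst-wkTm (idSub `, u) (keep o) (subst (wkSub (drop ⊆-refl) s `, var ze) t) ⟩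
  subst ((idSub ↾ o) `, u) (subst (wkSub (drop ⊆-refl) s `, var ze) t)
    ≡⟨ subst-subst ((idSub ↾ o) `, u) _ t ⟩
  subst ((((idSub ↾ o) `, u) ⊙ wkSub (drop ⊆-refl) s) `, u) t
    ≡⟨ cong (λ s' → subst (s' `, u) t) (⊙-wkSub ((idSub ↾ o) `, u) (drop ⊆-refl) s) ⟩
  subst ((((idSub ↾ o) `, u) ↾ drop ⊆-refl ⊙ s) `, u) t
    ≡⟨ cong (λ s' → subst ((s' ⊙ s) `, u) t) (↾-⊆-refl _) ⟩
  subst (((idSub ↾ o) ⊙ s) `, u) t
    ≡⟨ cong (λ s' → subst (s' `, u) t) (idSub↾-⊙ o s) ⟩
  subst (wkSub o s `, u) t ∎
  where open ≡-Reasoning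

wkTm-box-β : (o : Θ ⊆ Θ') (s : Sub Θ Γ) (t : Tm (Γ ,🔒) A) (e : Θ' ◁ Δ) →
  wkTm (◁⇒⊆ e) (wkTm (keep🔒 o) (subst (lock s nil) t)) ≡ subst (lock (wkSub o s) e) t
wkTm-box-β o s t e = trans (wkTm-∙ _ _ _)
  (trans (wkTm-subst _ _ t) (cong (λ F → subst (lockᶠ s F) t) (factor-nil-◁⇒⊆ o e)))

fundamental : (t : Tm Γ A) {s : Sub Θ Γ} {γ : ⟦ Γ ⟧Ctx Θ} → RelatedSub s γ → Related A (subst s t) (eval t Θ γ)
fundamental (var x)     p = RelatedSub-lookup x p
fundamental (lam {B = B} t) {s} p = λ Γ' o u a q →
  Related-≈ B (≈-sym (≈-trans (⇒-β _ u) (≡⇒≈ (subst-lam-β o s t u)))) (fundamental t (RelatedSub-wk o p ,ᴿ q))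
fundamental (app {B = B} t u) {s} p =
  Related-≡ B (cong (λ t' → app t' (subst s u)) (wkTm-id _)) (fundamental t p _ ⊆-refl (subst s u) _ (fundamental u p))
fundamental (box {A = A} t) {s} p = λ Γ' o Δ e →
  Related-≈ A (≈-sym (≈-trans (□-β _ e) (≡⇒≈ (wkTm-box-β o s t e)))) (fundamental t (lockᴿ (RelatedSub-wk o p)))
fundamental (unbox {A = A} t e) {s} {γ} p = unbox-Related (RelatedSub-unlock e p)
  where
  unbox-Related : ∀ {S U} → RelatedLocked S U →
    Related A (unboxˢ t S) (let (u , δ , e') = U in eval t u δ u ⊆-refl _ e')
  unbox-Related (mkᴿ q) = Related-≡ A (cong (λ t' → unbox t' _) (wkTm-id _)) (fundamental t q _ ⊆-refl _ _)

adequacy : (t : Tm Γ A) → t ≈ embNf (quoteᴹ (eval t))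
adequacy {Γ} {A} t = ≈-trans (≡⇒≈ (sym (subst-idSub t))) (reify-Related A _ (fundamental t (RelatedSub-idSub Γ)))

-- Completeness

-- Model functions need not be natural in the world, so equality of values also demands
-- uniformity: applying at a world and then weakening agrees with weakening first.
Eq : ∀ A {w} → ⟦ A ⟧Ty w → ⟦ A ⟧Ty w → Set
Eq ι n m = n ≡ m
Eq (A ⇒ B) {w} f g =
  (∀ w' (o : w ⊆ w') a b → Eq A a b → Eq B (f w' o a) (g w' o b)) ×
  (∀ w' w'' (o : w ⊆ w') (o' : w' ⊆ w'') a b → Eq A a b →
     Eq B (wkTy B o' (f w' o a)) (g w'' (o ∙ o') (wkTy A o' b)))
Eq (□ A) {w} f g =
  (∀ w' (o : w ⊆ w') v (e : w' ◁ v) → Eq A (f w' o v e) (g w' o v e)) ×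
  (∀ w' (o : w ⊆ w') v (e : w' ◁ v) v' (o' : v ⊆ v') →
     Eq A (wkTy A o' (f w' o v e)) (let (w'' , o'' , e') = factor e o' in g w'' (o ∙ o'') v' e'))

Eq-sym   : ∀ A {a b : ⟦ A ⟧Ty w} → Eq A a b → Eq A b a
Eq-trans : ∀ A {a b c : ⟦ A ⟧Ty w} → Eq A a b → Eq A b c → Eq A a c
Eq-wk    : ∀ A (o : w ⊆ w') {a b : ⟦ A ⟧Ty w} → Eq A a b → Eq A (wkTy A o a) (wkTy A o b)

Eq-reflˡ : ∀ A {a b : ⟦ A ⟧Ty w} → Eq A a b → Eq A a a
Eq-reflˡ A p = Eq-trans A p (Eq-sym A p)

Eq-reflʳ : ∀ A {a b : ⟦ A ⟧Ty w} → Eq A a b → Eq A b b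
Eq-reflʳ A p = Eq-trans A (Eq-sym A p) p

Eq-sym ι p = sym p
Eq-sym (A ⇒ B) (p₁ , p₂) =
  (λ w' o a b q → Eq-sym B (p₁ w' o b a (Eq-sym A q))) ,
  (λ w' w'' o o' a b q →
     Eq-trans B (Eq-wk B o' (Eq-sym B (p₁ w' o a a (Eq-reflˡ A q))))
       (Eq-trans B (p₂ w' w'' o o' a a (Eq-reflˡ A q))
         (Eq-sym B (p₁ w'' (o ∙ o') _ _ (Eq-wk A o' (Eq-sym A q))))))
Eq-sym (□ A) (p₁ , p₂) =
  (λ w' o v e → Eq-sym A (p₁ w' o v e)) ,
  (λ w' o v e v' o' → Eq-trans A (Eq-wk A o' (Eq-sym A (p₁ w' o v e)))
     (Eq-trans A (p₂ w' o v e v' o') (Eq-sym A (p₁ _ _ _ _))))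

Eq-trans ι p q = trans p q
Eq-trans (A ⇒ B) (p₁ , p₂) (q₁ , q₂) =
  (λ w' o a b r → Eq-trans B (p₁ w' o a b r) (q₁ w' o b b (Eq-reflʳ A r))) ,
  (λ w' w'' o o' a b r → Eq-trans B (p₂ w' w'' o o' a b r) (q₁ w'' (o ∙ o') _ _ (Eq-wk A o' (Eq-reflʳ A r))))
Eq-trans (□ A) (p₁ , p₂) (q₁ , q₂) =
  (λ w' o v e → Eq-trans A (p₁ w' o v e) (q₁ w' o v e)) ,
  (λ w' o v e v' o' → Eq-trans A (p₂ w' o v e v' o') (q₁ _ _ _ _))

Eq-wk ι o p = cong (wkNe o) p
Eq-wk (A ⇒ B) o {f} {g} (p₁ , p₂) =
  (λ w' o₁ a b r → p₁ w' (o ∙ o₁) a b r) ,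
  (λ w' w'' o₁ o₂ a b r → transport (λ o₃ → Eq B (wkTy B o₂ (f w' (o ∙ o₁) a)) (g w'' o₃ (wkTy A o₂ b)))
     (∙-assoc o o₁ o₂) (p₂ w' w'' (o ∙ o₁) o₂ a b r))
Eq-wk (□ A) o {f} {g} (p₁ , p₂) =
  (λ w' o₁ v e → p₁ w' (o ∙ o₁) v e) ,
  (λ w' o₁ v e v' o' → transport (λ o₃ → Eq A (wkTy A o' (f w' (o ∙ o₁) v e)) (g _ o₃ v' _))
     (∙-assoc o o₁ _) (p₂ w' (o ∙ o₁) v e v' o'))

Eq⇒-respʳ : {f g g' : ⟦ A ⇒ B ⟧Ty w} → Eq (A ⇒ B) f g → (∀ w' o a → g w' o a ≡ g' w' o a) → Eq (A ⇒ B) f g'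
Eq⇒-respʳ {B = B} (p₁ , p₂) g≡g' =
  (λ w' o a b r → transport (Eq B _) (g≡g' w' o b) (p₁ w' o a b r)) ,
  (λ w' w'' o o' a b r → transport (Eq B _) (g≡g' _ _ _) (p₂ w' w'' o o' a b r))

Eq□-respʳ : {f g g' : ⟦ □ A ⟧Ty w} → Eq (□ A) f g → (∀ w' o v e → g w' o v e ≡ g' w' o v e) → Eq (□ A) f g'
Eq□-respʳ {A = A} (p₁ , p₂) g≡g' =
  (λ w' o v e → transport (Eq A _) (g≡g' w' o v e) (p₁ w' o v e)) ,
  (λ w' o v e v' o' → transport (Eq A _) (g≡g' _ _ _ _) (p₂ w' o v e v' o'))

Eq⇒-pointwise : {f g : ⟦ A ⇒ B ⟧Ty w} → Eq (A ⇒ B) f f →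
  (∀ w' o a b → Eq A a b → Eq B (f w' o a) (g w' o b)) → Eq (A ⇒ B) f g
Eq⇒-pointwise {A = A} {B = B} (_ , f-uniform) f≈g =
  f≈g , (λ w' w'' o o' a b r → Eq-trans B (f-uniform w' w'' o o' a a (Eq-reflˡ A r)) (f≈g w'' (o ∙ o') _ _ (Eq-wk A o' r)))

Eq□-pointwise : {f g : ⟦ □ A ⟧Ty w} → Eq (□ A) f f →
  (∀ w' o v e → Eq A (f w' o v e) (g w' o v e)) → Eq (□ A) f g
Eq□-pointwise {A = A} (_ , f-uniform) f≈g =
  f≈g , (λ w' o v e v' o' → Eq-trans A (f-uniform w' o v e v' o') (f≈g _ _ _ _))

wkTy-id : ∀ A {a b : ⟦ A ⟧Ty w} → Eq A a b → Eq A (wkTy A ⊆-refl a) b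
wkTy-id ι p = trans (wkNe-id _) p
wkTy-id (A ⇒ B) {a = f} p = Eq-sym (A ⇒ B)
  (Eq⇒-respʳ (Eq-sym (A ⇒ B) p) (λ w' o a → cong (λ o' → f w' o' a) (sym (∙-identityˡ o))))
wkTy-id (□ A) {a = f} p = Eq-sym (□ A)
  (Eq□-respʳ (Eq-sym (□ A) p) (λ w' o v e → cong (λ o' → f w' o' v e) (sym (∙-identityˡ o))))

wkTy-∙ : ∀ A {w''} (o : w ⊆ w') (o' : w' ⊆ w'') {a b : ⟦ A ⟧Ty w} → Eq A a b →
  Eq A (wkTy A o' (wkTy A o a)) (wkTy A (o ∙ o') b)
wkTy-∙ ι o o' p = trans (wkNe-∙ o o' _) (cong (wkNe (o ∙ o')) p)
wkTy-∙ (A ⇒ B) o o' {b = g} p = Eq⇒-respʳ (Eq-wk (A ⇒ B) o' (Eq-wk (A ⇒ B) o p))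
  (λ w' o₂ a → cong (λ o₃ → g w' o₃ a) (sym (∙-assoc o o' o₂)))
wkTy-∙ (□ A) o o' {b = g} p = Eq□-respʳ (Eq-wk (□ A) o' (Eq-wk (□ A) o p))
  (λ w' o₂ v e → cong (λ o₃ → g w' o₃ v e) (sym (∙-assoc o o' o₂)))

reify-Eq    : ∀ A {a b : ⟦ A ⟧Ty w} → Eq A a b → reify A a ≡ reify A b
reflect-Eq  : ∀ A (n : Ne w A) → Eq A (reflect A n) (reflect A n)
reflect-wk  : ∀ A (o : w ⊆ w') (n : Ne w A) → Eq A (wkTy A o (reflect A n)) (reflect A (wkNe o n))
reify-wk    : ∀ A (o : w ⊆ w') {a b : ⟦ A ⟧Ty w} → Eq A a b → wkNf o (reify A a) ≡ reify A (wkTy A o b)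

reflect-≡ : ∀ A {n m : Ne w A} → n ≡ m → Eq A (reflect A n) (reflect A m)
reflect-≡ A {n} refl = reflect-Eq A n

reify-Eq ι       p         = cong up p
reify-Eq (A ⇒ B) (p₁ , _) = cong lam (reify-Eq B (p₁ _ (drop ⊆-refl) _ _ (reflect-Eq A (var ze))))
reify-Eq (□ A)   (p₁ , _) = cong box (reify-Eq A (p₁ _ ⊆-refl _ nil))

reflect-Eq ι n = refl
reflect-Eq (A ⇒ B) n =
  (λ w' o a b q → reflect-≡ B (cong (app (wkNe o n)) (reify-Eq A q))) ,
  (λ w' w'' o o' a b q → Eq-trans B (reflect-wk B o' (app (wkNe o n) (reify A a)))
     (reflect-≡ B (cong₂ app (wkNe-∙ o o' n) (reify-wk A o' q))))
reflect-Eq (□ A) n =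
  (λ w' o v e → reflect-Eq A _) ,
  (λ w' o v e v' o' → Eq-trans A (reflect-wk A o' (unbox (wkNe o n) e))
     (reflect-≡ A (cong (λ m → unbox m _) (wkNe-∙ o _ n))))

reflect-wk ι o n = refl
reflect-wk (A ⇒ B) o n = Eq⇒-pointwise (Eq-wk (A ⇒ B) o (reflect-Eq (A ⇒ B) n))
  (λ w' o₁ a b q → reflect-≡ B (cong₂ app (sym (wkNe-∙ o o₁ n)) (reify-Eq A q)))
reflect-wk (□ A) o n = Eq□-pointwise (Eq-wk (□ A) o (reflect-Eq (□ A) n))
  (λ w' o₁ v e → reflect-≡ A (cong (λ m → unbox m e) (sym (wkNe-∙ o o₁ n))))

reify-wk ι o p = cong (λ n → up (wkNe o n)) p
reify-wk (A ⇒ B) o {f} {g} p = cong lam (begin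
  wkNf (keep o) (reify B (f _ (drop ⊆-refl) x₀))
    ≡⟨ reify-wk B (keep o) (proj₁ p _ (drop ⊆-refl) _ _ x₀-Eq) ⟩
  reify B (wkTy B (keep o) (g _ (drop ⊆-refl) x₀))
    ≡⟨ reify-Eq B (Eq-trans B (g-uniform _ _ (drop ⊆-refl) (keep o) _ _ x₀-Eq)
                               (g-pointwise _ (drop (⊆-refl ∙ o)) _ _ (reflect-wk A (keep o) (var ze)))) ⟩
  reify B (g _ (drop (⊆-refl ∙ o)) x₀)
    ≡⟨ cong (λ o' → reify B (g _ (drop o') x₀)) (⊆-refl-central o) ⟩
  reify B (g _ (drop (o ∙ ⊆-refl)) x₀) ∎)
  where
  open ≡-Reasoning
  x₀ : ∀ {Γ} → ⟦ A ⟧Ty (Γ `, A)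
  x₀ = reflect A (var ze)
  x₀-Eq : ∀ {Γ} → Eq A (x₀ {Γ}) x₀
  x₀-Eq = reflect-Eq A (var ze)
  g-pointwise = proj₁ (Eq-reflʳ (A ⇒ B) p)
  g-uniform = proj₂ (Eq-reflʳ (A ⇒ B) p)
reify-wk (□ A) o {f} {g} p = cong box (begin
  wkNf (keep🔒 o) (reify A (f _ ⊆-refl _ nil))
    ≡⟨ reify-wk A (keep🔒 o) (proj₁ p _ ⊆-refl _ nil) ⟩
  reify A (wkTy A (keep🔒 o) (g _ ⊆-refl _ nil))
    ≡⟨ reify-Eq A (proj₂ (Eq-reflʳ (□ A) p) _ ⊆-refl _ nil _ (keep🔒 o)) ⟩
  reify A (g _ (⊆-refl ∙ o) _ nil)
    ≡⟨ cong (λ o' → reify A (g _ o' _ nil)) (⊆-refl-central o) ⟩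
  reify A (g _ (o ∙ ⊆-refl) _ nil) ∎)
  where open ≡-Reasoning

data EqCtx : ∀ Γ {w} → ⟦ Γ ⟧Ctx w → ⟦ Γ ⟧Ctx w → Set where
  []ᴱ   : EqCtx [] {w} tt tt
  _,ᴱ_  : {γ δ : ⟦ Γ ⟧Ctx w} {a b : ⟦ A ⟧Ty w} → EqCtx Γ γ δ → Eq A a b → EqCtx (Γ `, A) (γ , a) (δ , b)
  lockᴱ : {γ δ : ⟦ Γ ⟧Ctx Δ} {e : Δ ◁ w} → EqCtx Γ γ δ → EqCtx (Γ ,🔒) {w} (Δ , γ , e) (Δ , δ , e)

EqCtx-sym : {γ δ : ⟦ Γ ⟧Ctx w} → EqCtx Γ γ δ → EqCtx Γ δ γ
EqCtx-sym []ᴱ                 = []ᴱ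
EqCtx-sym (_,ᴱ_ {A = A} p q) = EqCtx-sym p ,ᴱ Eq-sym A q
EqCtx-sym (lockᴱ p)           = lockᴱ (EqCtx-sym p)

EqCtx-trans : {γ δ θ : ⟦ Γ ⟧Ctx w} → EqCtx Γ γ δ → EqCtx Γ δ θ → EqCtx Γ γ θ
EqCtx-trans []ᴱ                 []ᴱ         = []ᴱ
EqCtx-trans (_,ᴱ_ {A = A} p q) (p' ,ᴱ q') = EqCtx-trans p p' ,ᴱ Eq-trans A q q'
EqCtx-trans (lockᴱ p)           (lockᴱ p')  = lockᴱ (EqCtx-trans p p')

EqCtx-reflˡ : {γ δ : ⟦ Γ ⟧Ctx w} → EqCtx Γ γ δ → EqCtx Γ γ γ
EqCtx-reflˡ p = EqCtx-trans p (EqCtx-sym p)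

EqCtx-reflʳ : {γ δ : ⟦ Γ ⟧Ctx w} → EqCtx Γ γ δ → EqCtx Γ δ δ
EqCtx-reflʳ p = EqCtx-trans (EqCtx-sym p) p

wkCtx-Eq : (o : w ⊆ w') {γ δ : ⟦ Γ ⟧Ctx w} → EqCtx Γ γ δ → EqCtx Γ (wkCtx Γ o γ) (wkCtx Γ o δ)
wkCtx-Eq o []ᴱ                 = []ᴱ
wkCtx-Eq o (_,ᴱ_ {A = A} p q) = wkCtx-Eq o p ,ᴱ Eq-wk A o q
wkCtx-Eq o (lockᴱ p)           = lockᴱ (wkCtx-Eq _ p)

wkCtx-id : {γ δ : ⟦ Γ ⟧Ctx w} → EqCtx Γ γ δ → EqCtx Γ (wkCtx Γ ⊆-refl γ) δ
wkCtx-id []ᴱ                 = []ᴱ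
wkCtx-id (_,ᴱ_ {A = A} p q) = wkCtx-id p ,ᴱ wkTy-id A q
wkCtx-id {Γ ,🔒} (lockᴱ {γ = γ} {e = e} p) = lock-Eq (factor e ⊆-refl) (factor-⊆-refl e)
  where
  lock-Eq : (F : Factorisation _ _) → F ≡ (_ , ⊆-refl , e) →
    EqCtx (Γ ,🔒) (let (Δ' , o , e') = F in Δ' , wkCtx Γ o γ , e') _
  lock-Eq _ refl = lockᴱ (wkCtx-id p)

wkCtx-∙ : ∀ {w''} (o : w ⊆ w') (o' : w' ⊆ w'') {γ δ : ⟦ Γ ⟧Ctx w} → EqCtx Γ γ δ →
  EqCtx Γ (wkCtx Γ o' (wkCtx Γ o γ)) (wkCtx Γ (o ∙ o') δ)
wkCtx-∙ o o' []ᴱ                 = []ᴱ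
wkCtx-∙ o o' (_,ᴱ_ {A = A} p q) = wkCtx-∙ o o' p ,ᴱ wkTy-∙ A o o' q
wkCtx-∙ {Γ = Γ ,🔒} o o' (lockᴱ {γ = γ} {δ = δ} {e = e} p) = lock-Eq (factor e (o ∙ o')) (factor-∙ e o o')
  where
  lock-Eq : (F : Factorisation _ _) → F ≡ factor e o ∙ᶠ o' →
    EqCtx (Γ ,🔒) (let (_ , o₁ , e₁) = factor e o ; (Δ₂ , o₂ , e₂) = factor e₁ o' in Δ₂ , wkCtx Γ o₂ (wkCtx Γ o₁ γ) , e₂)
                  (let (Δ' , o'' , e') = F in Δ' , wkCtx Γ o'' δ , e')
  lock-Eq _ refl = lockᴱ (wkCtx-∙ _ _ p)

lookupVar-Eq : (x : Var Γ A) {γ δ : ⟦ Γ ⟧Ctx w} → EqCtx Γ γ δ → Eq A (lookupVar x γ) (lookupVar x δ)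
lookupVar-Eq ze     (p ,ᴱ q) = q
lookupVar-Eq (su x) (p ,ᴱ q) = lookupVar-Eq x p

lookupVar-wk : (x : Var Γ A) (o : w ⊆ w') {γ δ : ⟦ Γ ⟧Ctx w} → EqCtx Γ γ δ →
  Eq A (wkTy A o (lookupVar x γ)) (lookupVar x (wkCtx Γ o δ))
lookupVar-wk ze     o (_,ᴱ_ {A = A} p q) = Eq-wk A o q
lookupVar-wk (su x) o (p ,ᴱ q)           = lookupVar-wk x o p

unlock-Eq : (e : Δ ◁ Γ) {γ δ : ⟦ Γ ⟧Ctx w} → EqCtx Γ γ δ → EqCtx (Δ ,🔒) (unlock e γ) (unlock e δ)
unlock-Eq nil     p        = p
unlock-Eq (ext e) (p ,ᴱ q) = unlock-Eq e p

unlock-wkCtx : (e : Δ ◁ Γ) (o : w ⊆ w') (γ : ⟦ Γ ⟧Ctx w) → unlock e (wkCtx Γ o γ) ≡ wkCtx (Δ ,🔒) o (unlock e γ)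
unlock-wkCtx nil     o γ = refl
unlock-wkCtx (ext e) o γ = unlock-wkCtx e o (proj₁ γ)

renCtx : Γ ⊆ Γ' → ⟦ Γ' ⟧Ctx w → ⟦ Γ ⟧Ctx w
renCtx base       tt          = tt
renCtx (drop o)   (γ , a)     = renCtx o γ
renCtx (keep o)   (γ , a)     = renCtx o γ , a
renCtx (keep🔒 o) (u , γ , e) = u , renCtx o γ , e

renCtx-Eq : (o : Γ ⊆ Γ') {γ δ : ⟦ Γ' ⟧Ctx w} → EqCtx Γ' γ δ → EqCtx Γ (renCtx o γ) (renCtx o δ)
renCtx-Eq base       []ᴱ       = []ᴱ
renCtx-Eq (drop o)   (p ,ᴱ q)  = renCtx-Eq o p
renCtx-Eq (keep o)   (p ,ᴱ q)  = renCtx-Eq o p ,ᴱ q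
renCtx-Eq (keep🔒 o) (lockᴱ p) = lockᴱ (renCtx-Eq o p)

renCtx-id : {γ δ : ⟦ Γ ⟧Ctx w} → EqCtx Γ γ δ → EqCtx Γ (renCtx ⊆-refl γ) δ
renCtx-id []ᴱ       = []ᴱ
renCtx-id (p ,ᴱ q)  = renCtx-id p ,ᴱ q
renCtx-id (lockᴱ p) = lockᴱ (renCtx-id p)

renCtx-wkCtx : (o : Γ ⊆ Γ') (o' : w ⊆ w') {γ δ : ⟦ Γ' ⟧Ctx w} → EqCtx Γ' γ δ →
  EqCtx Γ (renCtx o (wkCtx Γ' o' γ)) (wkCtx Γ o' (renCtx o δ))
renCtx-wkCtx base               o' []ᴱ       = []ᴱ
renCtx-wkCtx (drop o)           o' (p ,ᴱ q)  = renCtx-wkCtx o o' p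
renCtx-wkCtx (keep {A = A} o)   o' (p ,ᴱ q)  = renCtx-wkCtx o o' p ,ᴱ Eq-wk A o' q
renCtx-wkCtx (keep🔒 o)         o' (lockᴱ p) = lockᴱ (renCtx-wkCtx o _ p)

lookupVar-wkVar : (o : Γ ⊆ Γ') (x : Var Γ A) {γ δ : ⟦ Γ' ⟧Ctx w} → EqCtx Γ' γ δ →
  Eq A (lookupVar (wkVar o x) γ) (lookupVar x (renCtx o δ))
lookupVar-wkVar (drop o) x      (p ,ᴱ q) = lookupVar-wkVar o x p
lookupVar-wkVar (keep o) ze     (p ,ᴱ q) = q
lookupVar-wkVar (keep o) (su x) (p ,ᴱ q) = lookupVar-wkVar o x p

unlock-renCtx : (e : Δ ◁ Γ) (o : Γ ⊆ Γ') (γ : ⟦ Γ' ⟧Ctx w) →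
  unlock e (renCtx o γ) ≡ (let (_ , o' , e') = factor e o in renCtx (keep🔒 o') (unlock e' γ))
unlock-renCtx nil     (drop o)   γ = unlock-renCtx nil o (proj₁ γ)
unlock-renCtx nil     (keep🔒 o) γ = refl
unlock-renCtx (ext e) (drop o)   γ = unlock-renCtx (ext e) o (proj₁ γ)
unlock-renCtx (ext e) (keep o)   γ = unlock-renCtx e o (proj₁ γ)

renCtx-◁⇒⊆ : (e : Δ ◁ Γ) (γ : ⟦ Γ ⟧Ctx w) → renCtx (◁⇒⊆ e) γ ≡ renCtx (keep🔒 ⊆-refl) (unlock e γ)
renCtx-◁⇒⊆ nil     γ = refl
renCtx-◁⇒⊆ (ext e) γ = renCtx-◁⇒⊆ e (proj₁ γ)

mapLock : (∀ {u} → ⟦ Δ ⟧Ctx u → ⟦ Γ ⟧Ctx u) → ⟦ Δ ,🔒 ⟧Ctx w → ⟦ Γ ,🔒 ⟧Ctx w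
mapLock F (u , δ , e) = u , F δ , e

mapLock-Eq : {F G : ∀ {u} → ⟦ Δ ⟧Ctx u → ⟦ Γ ⟧Ctx u} →
  (∀ {u} {γ δ : ⟦ Δ ⟧Ctx u} → EqCtx Δ γ δ → EqCtx Γ (F γ) (G δ)) →
  {U V : ⟦ Δ ,🔒 ⟧Ctx w} → EqCtx (Δ ,🔒) U V → EqCtx (Γ ,🔒) (mapLock F U) (mapLock G V)
mapLock-Eq F≈G (lockᴱ q) = lockᴱ (F≈G q)

evalSub : Sub Θ Δ → ⟦ Θ ⟧Ctx w → ⟦ Δ ⟧Ctx w
evalSub []         γ = tt
evalSub (s `, t)   γ = evalSub s γ , eval t _ γ
evalSub (lock s e) γ = mapLock (evalSub s) (unlock e γ)

unlock-evalSub : (e : Δ ◁ Γ) (s : Sub Θ Γ) (γ : ⟦ Θ ⟧Ctx w) →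
  unlock e (evalSub s γ) ≡ (let (_ , s' , e') = factorSub e s in evalSub (lock s' e') γ)
unlock-evalSub nil     (lock s e) γ = refl
unlock-evalSub (ext e) (s `, t)   γ = unlock-evalSub e s γ

openBox : M Δ (□ A) → ⟦ Δ ,🔒 ⟧Ctx w → ⟦ A ⟧Ty w
openBox f (u , δ , e) = f u δ u ⊆-refl _ e

openBox-Eq : {f g : M Δ (□ A)} → (∀ {u} {γ δ : ⟦ Δ ⟧Ctx u} → EqCtx Δ γ δ → Eq (□ A) (f u γ) (g u δ)) →
  {U V : ⟦ Δ ,🔒 ⟧Ctx w} → EqCtx (Δ ,🔒) U V → Eq A (openBox f U) (openBox g V)
openBox-Eq f≈g (lockᴱ q) = proj₁ (f≈g q) _ ⊆-refl _ _

openBox-wk : {f : M Δ (□ A)} →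
  (∀ {u} {γ δ : ⟦ Δ ⟧Ctx u} → EqCtx Δ γ δ → Eq (□ A) (f u γ) (f u δ)) →
  (∀ {u u'} (o : u ⊆ u') {γ δ : ⟦ Δ ⟧Ctx u} → EqCtx Δ γ δ → Eq (□ A) (wkTy (□ A) o (f u γ)) (f u' (wkCtx Δ o δ))) →
  (o : w ⊆ w') {U V : ⟦ Δ ,🔒 ⟧Ctx w} → EqCtx (Δ ,🔒) U V → Eq A (wkTy A o (openBox f U)) (openBox f (wkCtx (Δ ,🔒) o V))
openBox-wk {Δ = Δ} {A = A} {w' = w'} {f = f} f-Eq f-wk o (lockᴱ {γ = γ} {δ = δ} {e = e} q) =
  Eq-trans A (proj₂ (f-Eq (EqCtx-reflˡ q)) _ ⊆-refl _ e w' o)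
    (transport (λ o₁ → Eq A (f _ γ u' o₁ w' e') (f u' (wkCtx Δ o' δ) u' ⊆-refl w' e'))
       (sym (⊆-refl-central o'))
       (proj₁ (f-wk o' q) u' ⊆-refl w' e'))
  where
  u' = proj₁ (factor e o)
  o' = proj₁ (proj₂ (factor e o))
  e' = proj₂ (proj₂ (factor e o))

eval-Eq : (t : Tm Γ A) {γ δ : ⟦ Γ ⟧Ctx w} → EqCtx Γ γ δ → Eq A (eval t w γ) (eval t w δ)
eval-wk : (t : Tm Γ A) (o : w ⊆ w') {γ δ : ⟦ Γ ⟧Ctx w} → EqCtx Γ γ δ →
  Eq A (wkTy A o (eval t w γ)) (eval t w' (wkCtx Γ o δ))

eval-Eq (var x) p = lookupVar-Eq x p
eval-Eq (lam {A = A} {B = B} t) p =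
  (λ w' o a b q → eval-Eq t (wkCtx-Eq o p ,ᴱ q)) ,
  (λ w' w'' o o' a b q → Eq-trans B (eval-wk t o' (wkCtx-Eq o p ,ᴱ q))
     (eval-Eq t (wkCtx-∙ o o' (EqCtx-reflʳ p) ,ᴱ Eq-wk A o' (Eq-reflʳ A q))))
eval-Eq (app t u) p = proj₁ (eval-Eq t p) _ ⊆-refl _ _ (eval-Eq u p)
eval-Eq (box {A = A} t) p =
  (λ w' o v e → eval-Eq t (lockᴱ (wkCtx-Eq o p))) ,
  (λ w' o v e v' o' → Eq-trans A (eval-wk t o' (lockᴱ (wkCtx-Eq o p))) (eval-Eq t (lockᴱ (wkCtx-∙ o _ (EqCtx-reflʳ p)))))
eval-Eq (unbox t e) p = openBox-Eq (eval-Eq t) (unlock-Eq e p)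

eval-wk (var x) o p = lookupVar-wk x o p
eval-wk (lam {A = A} {B = B} t) o p = Eq⇒-pointwise (Eq-wk (A ⇒ B) o (eval-Eq (lam t) (EqCtx-reflˡ p)))
  (λ w' o₁ a b q → eval-Eq t (EqCtx-sym (wkCtx-∙ o o₁ (EqCtx-sym p)) ,ᴱ q))
eval-wk {Γ = Γ} {w = w} {w' = w'} (app {A = A} {B = B} t u) o {γ} {δ} p =
  Eq-trans B (proj₂ (eval-Eq t (EqCtx-reflˡ p)) w w' ⊆-refl o _ _ (eval-Eq u (EqCtx-reflˡ p)))
    (transport (λ o' → Eq B (eval t w γ w' o' (wkTy A o (eval u w γ))) (eval t w' (wkCtx Γ o δ) w' ⊆-refl (eval u w' (wkCtx Γ o δ))))
       (sym (⊆-refl-central o))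
       (proj₁ (eval-wk t o p) w' ⊆-refl _ _ (eval-wk u o p)))
eval-wk (box {A = A} t) o p = Eq□-pointwise (Eq-wk (□ A) o (eval-Eq (box t) (EqCtx-reflˡ p)))
  (λ w' o₁ v e → eval-Eq t (lockᴱ (EqCtx-sym (wkCtx-∙ o o₁ (EqCtx-sym p)))))
eval-wk {A = A} (unbox t e) o {δ = δ} p =
  transport (λ V → Eq A _ (openBox (eval t) V)) (sym (unlock-wkCtx e o δ))
    (openBox-wk (eval-Eq t) (eval-wk t) o (unlock-Eq e p))

eval-wkTm : (o : Γ ⊆ Γ') (t : Tm Γ A) {γ δ : ⟦ Γ' ⟧Ctx w} → EqCtx Γ' γ δ →
  Eq A (eval (wkTm o t) w γ) (eval t w (renCtx o δ))
eval-wkTm o (var x) p = lookupVar-wkVar o x p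
eval-wkTm o (lam {A = A} {B = B} t) p = Eq⇒-pointwise (eval-Eq (wkTm o (lam t)) (EqCtx-reflˡ p))
  (λ w' o₁ a b q → Eq-trans B (eval-wkTm (keep o) t (wkCtx-Eq o₁ p ,ᴱ q))
     (eval-Eq t (renCtx-wkCtx o o₁ (EqCtx-reflʳ p) ,ᴱ Eq-reflʳ A q)))
eval-wkTm o (app t u) p = proj₁ (eval-wkTm o t p) _ ⊆-refl _ _ (eval-wkTm o u p)
eval-wkTm o (box {A = A} t) p = Eq□-pointwise (eval-Eq (wkTm o (box t)) (EqCtx-reflˡ p))
  (λ w' o₁ v e → Eq-trans A (eval-wkTm (keep🔒 o) t (lockᴱ (wkCtx-Eq o₁ p)))
     (eval-Eq t (lockᴱ (renCtx-wkCtx o o₁ (EqCtx-reflʳ p)))))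
eval-wkTm {A = A} o (unbox t e) {δ = δ} p =
  transport (λ V → Eq A _ (openBox (eval t) V)) (sym (unlock-renCtx e o δ))
    (openBox-Eq (eval-wkTm (proj₁ (proj₂ (factor e o))) t) (unlock-Eq (proj₂ (proj₂ (factor e o))) p))

evalSub-Eq : (s : Sub Θ Γ) {γ δ : ⟦ Θ ⟧Ctx w} → EqCtx Θ γ δ → EqCtx Γ (evalSub s γ) (evalSub s δ)
evalSub-Eq []         p = []ᴱ
evalSub-Eq (s `, t)   p = evalSub-Eq s p ,ᴱ eval-Eq t p
evalSub-Eq (lock s e) p = mapLock-Eq (evalSub-Eq s) (unlock-Eq e p)

evalSub-wkSub : (o : Θ ⊆ Θ') (s : Sub Θ Γ) {γ δ : ⟦ Θ' ⟧Ctx w} → EqCtx Θ' γ δ →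
  EqCtx Γ (evalSub (wkSub o s) γ) (evalSub s (renCtx o δ))
evalSub-wkSub o []         p = []ᴱ
evalSub-wkSub o (s `, t)   p = evalSub-wkSub o s p ,ᴱ eval-wkTm o t p
evalSub-wkSub {Γ = Γ ,🔒} o (lock s e) {δ = δ} p =
  transport (λ V → EqCtx (Γ ,🔒) _ (mapLock (evalSub s) V)) (sym (unlock-renCtx e o δ))
    (mapLock-Eq (evalSub-wkSub (proj₁ (proj₂ (factor e o))) s) (unlock-Eq (proj₂ (proj₂ (factor e o))) p))

evalSub-wkCtx : (s : Sub Θ Γ) (o : w ⊆ w') {γ δ : ⟦ Θ ⟧Ctx w} → EqCtx Θ γ δ →
  EqCtx Γ (evalSub s (wkCtx Θ o γ)) (wkCtx Γ o (evalSub s δ))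
evalSub-wkCtx []                 o p = []ᴱ
evalSub-wkCtx (_`,_ {A = A} s t) o p = evalSub-wkCtx s o p ,ᴱ Eq-sym A (eval-wk t o (EqCtx-sym p))
evalSub-wkCtx {Θ = Θ} {Γ = Γ ,🔒} (lock {Γ' = Δ} s e) o {γ} p =
  transport (λ U → EqCtx (Γ ,🔒) (mapLock (evalSub s) U) _) (sym (unlock-wkCtx e o γ)) (locked (unlock-Eq e p))
  where
  locked : {U V : ⟦ Δ ,🔒 ⟧Ctx _} → EqCtx (Δ ,🔒) U V →
    EqCtx (Γ ,🔒) (mapLock (evalSub s) (wkCtx (Δ ,🔒) o U)) (wkCtx (Γ ,🔒) o (mapLock (evalSub s) V))
  locked (lockᴱ q) = lockᴱ (evalSub-wkCtx s _ q)

evalSub-idSub : ∀ Γ {γ δ : ⟦ Γ ⟧Ctx w} → EqCtx Γ γ δ → EqCtx Γ (evalSub idSub γ) δ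
evalSub-idSub []       []ᴱ       = []ᴱ
evalSub-idSub (Γ `, A) (p ,ᴱ q)  =
  EqCtx-trans (evalSub-wkSub (drop ⊆-refl) idSub (EqCtx-reflˡ (p ,ᴱ q)))
    (evalSub-idSub Γ (EqCtx-trans (renCtx-id (EqCtx-reflˡ p)) p)) ,ᴱ q
evalSub-idSub (Γ ,🔒)  (lockᴱ p) = lockᴱ (evalSub-idSub Γ p)

eval-substVar : (s : Sub Θ Γ) (x : Var Γ A) {γ δ : ⟦ Θ ⟧Ctx w} → EqCtx Θ γ δ →
  Eq A (eval (substVar s x) w γ) (lookupVar x (evalSub s δ))
eval-substVar (s `, t) ze     p = eval-Eq t p
eval-substVar (s `, t) (su x) p = eval-substVar s x p

eval-subst : (s : Sub Θ Γ) (t : Tm Γ A) {γ δ : ⟦ Θ ⟧Ctx w} → EqCtx Θ γ δ →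
  Eq A (eval (subst s t) w γ) (eval t w (evalSub s δ))
eval-subst s (var x) p = eval-substVar s x p
eval-subst s (lam {A = A} {B = B} t) p = Eq⇒-pointwise (eval-Eq (subst s (lam t)) (EqCtx-reflˡ p))
  (λ w' o a b q → Eq-trans B (eval-subst _ t (wkCtx-Eq o p ,ᴱ q))
     (eval-Eq t (EqCtx-trans (evalSub-wkSub (drop ⊆-refl) s (EqCtx-reflʳ (wkCtx-Eq o p ,ᴱ q)))
                   (EqCtx-trans (evalSub-Eq s (renCtx-id (EqCtx-reflʳ (wkCtx-Eq o p))))
                     (evalSub-wkCtx s o (EqCtx-reflʳ p))) ,ᴱ Eq-reflʳ A q)))
eval-subst s (app t u) p = proj₁ (eval-subst s t p) _ ⊆-refl _ _ (eval-subst s u p)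
eval-subst s (box {A = A} t) p = Eq□-pointwise (eval-Eq (subst s (box t)) (EqCtx-reflˡ p))
  (λ w' o v e → Eq-trans A (eval-subst (lock s nil) t (lockᴱ (wkCtx-Eq o p)))
     (eval-Eq t (lockᴱ (evalSub-wkCtx s o (EqCtx-reflʳ p)))))
eval-subst {A = A} s (unbox t e) {δ = δ} p =
  transport (λ V → Eq A _ (openBox (eval t) V)) (sym (unlock-evalSub e s δ))
    (openBox-Eq (eval-subst (proj₁ (proj₂ (factorSub e s))) t) (unlock-Eq (proj₂ (proj₂ (factorSub e s))) p))

eval-≈ : {t u : Tm Γ A} → t ≈ u → {γ δ : ⟦ Γ ⟧Ctx w} → EqCtx Γ γ δ → Eq A (eval t w γ) (eval u w δ)
eval-≈ {t = t} ≈-refl p = eval-Eq t p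
eval-≈ {A = A} (≈-sym r) p = Eq-sym A (eval-≈ r (EqCtx-sym p))
eval-≈ {A = A} (≈-trans r r') p = Eq-trans A (eval-≈ r (EqCtx-reflˡ p)) (eval-≈ r' p)
eval-≈ {t = lam t} (cong-lam r) p = Eq⇒-pointwise (eval-Eq (lam t) (EqCtx-reflˡ p))
  (λ w' o a b q → eval-≈ r (wkCtx-Eq o p ,ᴱ q))
eval-≈ (cong-app r r') p = proj₁ (eval-≈ r p) _ ⊆-refl _ _ (eval-≈ r' p)
eval-≈ {t = box t} (cong-box r) p = Eq□-pointwise (eval-Eq (box t) (EqCtx-reflˡ p))
  (λ w' o v e → eval-≈ r (lockᴱ (wkCtx-Eq o p)))
eval-≈ (cong-unbox {e = e} r) p = openBox-Eq (eval-≈ r) (unlock-Eq e p)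
eval-≈ {Γ = Γ} {A = B} (⇒-β t u) p =
  Eq-trans B (eval-Eq t (EqCtx-trans (wkCtx-id p) (EqCtx-sym (evalSub-idSub Γ (EqCtx-reflʳ p))) ,ᴱ eval-Eq u p))
    (Eq-sym B (eval-subst (idSub `, u) t (EqCtx-reflʳ p)))
eval-≈ {Γ = Γ} {A = A ⇒ B} {w = w} (⇒-η t) {γ} {δ} p = Eq⇒-pointwise (eval-Eq t (EqCtx-reflˡ p))
  (λ w' o a b q → Eq-trans B
     (transport (λ o' → Eq B (eval t w γ w' o' a) (eval t w' (wkCtx Γ o δ) w' ⊆-refl b))
        (∙-identityʳ o) (proj₁ (eval-wk t o p) w' ⊆-refl a b q))
     (Eq-sym B (proj₁ (Eq-trans (A ⇒ B)
        (eval-wkTm (drop ⊆-refl) t (EqCtx-reflʳ (wkCtx-Eq o p ,ᴱ q)))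
        (eval-Eq t (renCtx-id (EqCtx-reflʳ (wkCtx-Eq o p))))) w' ⊆-refl b b (Eq-reflʳ A q))))
eval-≈ {A = A} (□-β {Δ = Δ} t e) {δ = δ} p =
  Eq-trans A
    (eval-Eq t (transport (EqCtx (Δ ,🔒) _) (sym (renCtx-◁⇒⊆ e δ))
      (mapLock-Eq (λ q → EqCtx-trans (wkCtx-id q) (EqCtx-sym (renCtx-id (EqCtx-reflʳ q)))) (unlock-Eq e p))))
    (Eq-sym A (eval-wkTm (◁⇒⊆ e) t (EqCtx-reflʳ p)))
eval-≈ {Γ = Γ} {A = □ A} {w = w} (□-η t) {γ} {δ} p = Eq□-pointwise (eval-Eq t (EqCtx-reflˡ p))
  (λ w' o v e → transport (λ o' → Eq A (eval t w γ w' o' v e) (eval t w' (wkCtx Γ o δ) w' ⊆-refl v e))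
     (∙-identityʳ o) (proj₁ (eval-wk t o p) w' ⊆-refl v e))

reflectCtx-Eq : ∀ Γ → EqCtx Γ (reflectCtx Γ) (reflectCtx Γ)
reflectCtx-Eq []       = []ᴱ
reflectCtx-Eq (Γ `, A) = wkCtx-Eq (drop ⊆-refl) (reflectCtx-Eq Γ) ,ᴱ reflect-Eq A (var ze)
reflectCtx-Eq (Γ ,🔒)  = lockᴱ (reflectCtx-Eq Γ)

completeness : ∀ {Γ A} (t u : Tm Γ A) → t ≈ u → quoteᴹ (eval t) ≡ quoteᴹ (eval u)
completeness {Γ} {A} t u r = reify-Eq A (eval-≈ r (reflectCtx-Eq Γ))

theorem3p6 : Σ (∀ {Γ A} → M Γ A → Nf Γ A) (λ qt →
                 (∀ {Γ A} (t u : Tm Γ A) → t ≈ u → qt (eval t) ≡ qt (eval u))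
                 × (∀ {Γ A} (t : Tm Γ A) → t ≈ embNf (qt (eval t))))
theorem3p6 = quoteᴹ , completeness , adequacy
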